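{- For every integer $n\geq 0$, $T_n\in P(T_{n+1},3^n\times 3^n)$, i.e. $T_n$ occurs as a contiguous $3^n\times 3^n$ submatrix of $T_{n+1}$.
   Context: Work over the alphabet $\{0,1\}$ and regard patterns as binary matrices. The block substitution $\mu$ maps $0$ to the $3\times3$ matrix with rows $(1,0,1),(0,0,0),(1,0,1)$ and $1$ to the $3\times3$ matrix with rows $(0,1,0),(1,1,1),(0,1,0)$; it acts on an $m\times n$ binary matrix by replacing each entry by its $3\times3$ image block. Let $T_k=\mu^k(0)$ for $k\ge 0$. For a pattern $S$, $P(S,m\times n)$ is the set of all $m\times n$ contiguous submatrices of $S$. -}

module Defs where

open import Data.Nat using (ℕ; zero; suc; _+_; _*_; _≤_; _<_)
open import Data.Nat.Properties using (+-monoʳ-<; <-≤-trans)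
open import Data.Fin using (Fin; toℕ; fromℕ<; quotient; remainder)
open import Data.Fin.Properties using (toℕ<n)
open import Data.Bool using (Bool; true; false)
import Data.Bool
import Data.Fin
open import Data.Product using (Σ; ∃; _×_; _,_)
open import Relation.Binary.PropositionalEquality using (_≡_)

Matrix : ℕ → ℕ → Set
Matrix m n = Fin m → Fin n → Bool

-- the 3×3 image blocks of 0 (= false) and 1 (= true)
-- μ(0) rows: (1,0,1),(0,0,0),(1,0,1);  μ(1) rows: (0,1,0),(1,1,1),(0,1,0)
-- entry (r,c) of μ(0) is 1 iff r,c both even (r,c ∈ {0,2}); μ(1) is its complement
isEven3 : Fin 3 → Bool
isEven3 Fin.zero = true
isEven3 (Fin.suc Fin.zero) = false
isEven3 (Fin.suc (Fin.suc Fin.zero)) = true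

block : Bool → Fin 3 → Fin 3 → Bool
block false r c = Data.Bool._∧_ (isEven3 r) (isEven3 c)
block true  r c = Data.Bool.not (Data.Bool._∧_ (isEven3 r) (isEven3 c))

μ : ∀ {m n} → Matrix m n → Matrix (m * 3) (n * 3)
μ {m} {n} S x y = block (S (quotient 3 x) (quotient 3 y)) (remainder {m} 3 x) (remainder {n} 3 y)

-- side k = 3^k (written with the factor on the right to match the index of μ)
side : ℕ → ℕ
side zero = 1
side (suc k) = side k * 3

T : (k : ℕ) → Matrix (side k) (side k)
T zero _ _ = false
T (suc k) = μ (T k)

shift : ∀ {m M} (i : ℕ) → i + m ≤ M → Fin m → Fin M
shift {m} i le a = fromℕ< (<-≤-trans (+-monoʳ-< i (toℕ<n a)) le)

Occurs : ∀ {m n M N} → Matrix m n → Matrix M N → Set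
Occurs {m} {n} {M} {N} S S' =
  Σ ℕ λ i → Σ ℕ λ j → Σ (i + m ≤ M) λ pi → Σ (j + n ≤ N) λ pj →
    ∀ (a : Fin m) (b : Fin n) → S' (shift i pi a) (shift j pj b) ≡ S a b

{-# OPTIONS --safe #-}
-- Occurrence is preserved by μ: if S sits in S' at offset (i, j), then μ S sits in μ S' at
-- offset (3i, 3j), since both are obtained by replacing each entry by its block. As T₀ = 0 is
-- the centre entry of T₁ = μ(0), induction gives T n ∈ P(T (n + 1)) for every n.
module Submission where

open import Defs
open import Data.Nat using (ℕ; zero; suc; _+_; _*_; _≤_; s≤s; z≤n)
open import Data.Nat.Properties using (*-monoˡ-≤; *-distribʳ-+)
open import Data.Nat.Tactic.RingSolver using (solve-∀)
open import Data.Fin using (Fin; toℕ; quotient; remainder; combine)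
open import Data.Fin.Properties using (toℕ-fromℕ<; toℕ-combine; combine-remQuot; remQuot-combine; toℕ-injective)
open import Data.Product using (_,_; proj₁; proj₂)
open import Relation.Binary.PropositionalEquality using (_≡_; refl; sym; trans; cong; cong₂; subst; module ≡-Reasoning)

window-*3 : ∀ {i m M} → i + m ≤ M → i * 3 + m * 3 ≤ M * 3
window-*3 {i} {m} {M} i+m≤M = subst (_≤ M * 3) (*-distribʳ-+ 3 i m) (*-monoˡ-≤ 3 i+m≤M)

toℕ-shift : ∀ {m M} (i : ℕ) (i+m≤M : i + m ≤ M) (a : Fin m) → toℕ (shift i i+m≤M a) ≡ i + toℕ a
toℕ-shift i i+m≤M a = toℕ-fromℕ< _

toℕ-remQuot : ∀ {m} (a : Fin (m * 3)) → toℕ a ≡ 3 * toℕ (quotient {m} 3 a) + toℕ (remainder {m} 3 a)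
toℕ-remQuot {m} a = trans (cong toℕ (sym (combine-remQuot {m} 3 a))) (toℕ-combine (quotient {m} 3 a) (remainder {m} 3 a))

shift-*3 : ∀ {m M} (i : ℕ) (i+m≤M : i + m ≤ M) (a : Fin (m * 3)) →
  shift (i * 3) (window-*3 {i} i+m≤M) a ≡ combine (shift i i+m≤M (quotient 3 a)) (remainder {m} 3 a)
shift-*3 {m} i i+m≤M a = toℕ-injective (begin
  toℕ (shift (i * 3) (window-*3 {i} i+m≤M) a) ≡⟨ toℕ-shift (i * 3) (window-*3 {i} i+m≤M) a ⟩
  i * 3 + toℕ a                                 ≡⟨ cong (i * 3 +_) (toℕ-remQuot {m} a) ⟩
  i * 3 + (3 * toℕ q + toℕ r)                   ≡⟨ rearrange i (toℕ q) (toℕ r) ⟩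
  3 * (i + toℕ q) + toℕ r                       ≡⟨ cong (λ k → 3 * k + toℕ r) (sym (toℕ-shift i i+m≤M q)) ⟩
  3 * toℕ (shift i i+m≤M q) + toℕ r             ≡⟨ sym (toℕ-combine (shift i i+m≤M q) r) ⟩
  toℕ (combine (shift i i+m≤M q) r)             ∎)
  where
  open ≡-Reasoning
  q : Fin m
  q = quotient {m} 3 a
  r : Fin 3
  r = remainder {m} 3 a
  rearrange : ∀ x y z → x * 3 + (3 * y + z) ≡ 3 * (x + y) + z
  rearrange = solve-∀

μ-combine : ∀ {m n} (S : Matrix m n) (x : Fin m) (y : Fin n) (r c : Fin 3) →
  μ S (combine x r) (combine y c) ≡ block (S x y) r c
μ-combine S x y r c =
  cong₂ (λ u v → block (S (proj₁ u) (proj₁ v)) (proj₂ u) (proj₂ v)) (remQuot-combine x r) (remQuot-combine y c)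

Occurs-μ : ∀ {m n M N} {S : Matrix m n} {S' : Matrix M N} → Occurs S S' → Occurs (μ S) (μ S')
Occurs-μ {m} {n} {M} {N} {S} {S'} (i , j , i+m≤M , j+n≤N , S'≡S) =
  i * 3 , j * 3 , window-*3 {i} i+m≤M , window-*3 {j} j+n≤N , λ a b →
    let q = quotient {m} 3 a ; r = remainder {m} 3 a
        q' = quotient {n} 3 b ; c = remainder {n} 3 b
    in begin
      μ S' (row₃ a) (col₃ b)                         ≡⟨ cong₂ (μ S') (shift-*3 i i+m≤M a) (shift-*3 j j+n≤N b) ⟩
      μ S' (combine (row q) r) (combine (col q') c) ≡⟨ μ-combine S' (row q) (col q') r c ⟩
      block (S' (row q) (col q')) r c                ≡⟨ cong (λ v → block v r c) (S'≡S q q') ⟩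
      μ S a b                                        ∎
  where
  open ≡-Reasoning
  row : Fin m → Fin M
  row = shift i i+m≤M
  col : Fin n → Fin N
  col = shift j j+n≤N
  row₃ : Fin (m * 3) → Fin (M * 3)
  row₃ = shift (i * 3) (window-*3 {i} i+m≤M)
  col₃ : Fin (n * 3) → Fin (N * 3)
  col₃ = shift (j * 3) (window-*3 {j} j+n≤N)

lemma1 : ∀ (n : ℕ) → Occurs (T n) (T (suc n))
lemma1 zero = 1 , 1 , s≤s (s≤s z≤n) , s≤s (s≤s z≤n) , λ { Fin.zero Fin.zero → refl }
lemma1 (suc n) = Occurs-μ {S = T n} {S' = T (suc n)} (lemma1 n)
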